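{- Let $n_1,n_2,k$ be positive integers with $n_1,n_2\ge 2$. Let $\mathcal{T}$ be a family of types of binary structure of size $k$ that contains at least one type of the form $T_{a,b}$ with $a+b=k$. Let $a_{\min}$ be the minimum value of $a$ and $b_{\min}$ the minimum value of $b$ over the types $T_{a,b}\in\mathcal T$. Then \[ f(n_1,n_2,\mathcal{T})\le (a_{\min}-1)(n_2-2)+(b_{\min}-1)(n_1-2)+2k. \]
   Context: Top splitting level: for a set $S$ of at least two nonnegative integers, $\ell(S)$ is the largest nonnegative integer $\ell$ such that $\{\lfloor 2^{ -\ell}s\rfloor : s\in S\}$ has at least two elements; $S_{\mathrm{Left}}$ is the set of $s\in S$ with $\lfloor 2^{ -\ell(S)}s\rfloor$ even, $S_{\mathrm{Right}}$ those with it odd. Binary structure: $b(S)$ is the weighted rooted ordered binary tree defined recursively: if $|S|=1$ it is a single root of weight $1$; if $|S|>1$ the root has weight $|S|$, left subtree $b(S_{\mathrm{Left}})$ and right subtree $b(S_{\mathrm{Right}})$. $b(S)$ is increasing if the right subtree of every internal node is a single vertex, and decreasing if the left subtree of every internal node is a single vertex. A type of binary structure $T$ is a weighted rooted ordered binary tree whose leaves have positive integer weights and each internal vertex has weight equal to the sum of its children's weights; its size is the root weight. A set $S$ is of type $T$ if $T$ can be obtained from $b(S)$ by iteratively removing leaves (keeping the weights of remaining vertices). $T_{a,b}$ denotes the type consisting of a root of weight $a+b$ whose two children are leaves, of weight $a$ (left) and $b$ (right). For positive integers $n_1,n_2$ and a family $\mathcal T$ of types, $f(n_1,n_2,\mathcal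 T)$ is the maximum size of a set $S$ of nonnegative integers containing no $n_1$-subset with increasing binary structure, no $n_2$-subset with decreasing binary structure, and no subset of type $T$ for any $T\in\mathcal T$. -}

module Defs where

open import Data.Nat using (ℕ; zero; suc; _+_; _*_; _∸_; _≤_; _%_; ⌊_/2⌋)
open import Data.Nat.Properties using (_≟_)
open import Data.List using (List; []; _∷_; [_]; length; filter)
open import Data.List.Membership.Propositional using (_∈_)
open import Data.List.Relation.Binary.Sublist.Propositional using (_⊆_)
open import Data.List.Relation.Unary.Unique.Propositional using (Unique)
open import Data.Product using (Σ; ∃; ∃-syntax; _×_; _,_)
open import Relation.Binary.PropositionalEquality using (_≡_; _≢_)
open import Relation.Nullary using (¬_)

shiftR : ℕ → ℕ → ℕ
shiftR zero    s = s
shiftR (suc ℓ) s = ⌊ shiftR ℓ s /2⌋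

data Tree : Set where
  leaf : (w : ℕ) → Tree
  node : (w : ℕ) → (l r : Tree) → Tree

weight : Tree → ℕ
weight (leaf w)     = w
weight (node w _ _) = w

-- finite sets of nonnegative integers are lists without duplicates (Unique)

IsTopLevel : List ℕ → ℕ → Set
IsTopLevel S ℓ =
  (∃[ s ] ∃[ t ] (s ∈ S × t ∈ S × shiftR ℓ s ≢ shiftR ℓ t)) ×
  (∀ m → ℓ Data.Nat.< m → ∀ s t → s ∈ S → t ∈ S → shiftR m s ≡ shiftR m t)

Left : ℕ → List ℕ → List ℕ
Left ℓ = filter (λ s → shiftR ℓ s % 2 ≟ 0)

Right : ℕ → List ℕ → List ℕ
Right ℓ = filter (λ s → shiftR ℓ s % 2 ≟ 1)

data BinStr : List ℕ → Tree → Set where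
  single : ∀ x → BinStr [ x ] (leaf 1)
  split  : ∀ S ℓ L R → IsTopLevel S ℓ →
           BinStr (Left ℓ S) L → BinStr (Right ℓ S) R →
           BinStr S (node (length S) L R)

data Increasing : Tree → Set where
  leaf : ∀ w → Increasing (leaf w)
  node : ∀ w L v → Increasing L → Increasing (node w L (leaf v))

data Decreasing : Tree → Set where
  leaf : ∀ w → Decreasing (leaf w)
  node : ∀ w v R → Decreasing R → Decreasing (node w (leaf v) R)

data IsType : Tree → Set where
  leaf : ∀ w → 1 ≤ w → IsType (leaf w)
  node : ∀ L R → IsType L → IsType R →
         IsType (node (weight L + weight R) L R)

-- Prunes B T : T is obtained from B by iteratively removing leaves
-- (keeping weights of remaining vertices), resulting in a tree
data Prunes : Tree → Tree → Set where
  cut  : ∀ B → Prunes B (leaf (weight B))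
  node : ∀ w L R L' R' → Prunes L L' → Prunes R R' →
         Prunes (node w L R) (node w L' R')

T[_,_] : ℕ → ℕ → Tree
T[ a , b ] = node (a + b) (leaf a) (leaf b)

HasIncreasingStructure : List ℕ → Set
HasIncreasingStructure X = ∃[ B ] (BinStr X B × Increasing B)

HasDecreasingStructure : List ℕ → Set
HasDecreasingStructure X = ∃[ B ] (BinStr X B × Decreasing B)

OfType : List ℕ → Tree → Set
OfType X T = ∃[ B ] (BinStr X B × Prunes B T)

Avoids : ℕ → ℕ → (Tree → Set) → List ℕ → Set
Avoids n₁ n₂ 𝒯 S =
  (∀ X → X ⊆ S → length X ≡ n₁ → ¬ HasIncreasingStructure X) ×
  (∀ X → X ⊆ S → length X ≡ n₂ → ¬ HasDecreasingStructure X) ×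
  (∀ X T → X ⊆ S → 𝒯 T → ¬ OfType X T)

{-# OPTIONS --safe #-}
-- Split S at its top level into the halves L and R; each half is a proper, nonempty subset.
-- If |L| < amin, every decreasing subset of R extends by an element of L, so R avoids
-- decreasing (n₂ - 1)-subsets and induction on n₂ gives |S| ≤ (amin - 1) + bound(n₁, n₂ - 1);
-- the case |R| < bmin is symmetric with increasing subsets and n₁. Otherwise, with
-- T[amin, b] and T[a, bmin] in 𝒯, an amin-subset of L and a b-subset of R would form a
-- subset of type T[amin, b], so |R| < b ≤ k, and likewise |L| < a ≤ k.
module Submission where

open import Defs
open import Data.Empty using (⊥; ⊥-elim)
open import Data.List using (List; []; _∷_; [_]; length; filter; take)
open import Data.List.Membership.Propositional using (_∈_; find)
open import Data.List.Membership.Propositional.Properties using (∈-filter⁺; ∈-filter⁻)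
open import Data.List.Properties using (filter-accept; filter-reject; length-take)
open import Data.List.Relation.Binary.Sublist.Propositional using (_⊆_; []; _∷_; _∷ʳ_; ⊆-trans; from∈)
open import Data.List.Relation.Binary.Sublist.Propositional.Properties
  using (filter-⊆; take-⊆; All-resp-⊆; Any-resp-⊆)
open import Data.List.Relation.Unary.All as All using (All; _∷_)
open import Data.List.Relation.Unary.All.Properties using (¬All⇒Any¬)
open import Data.List.Relation.Unary.AllPairs using (_∷_)
open import Data.List.Relation.Unary.Any using (here; there)
open import Data.List.Relation.Unary.Unique.Propositional using (Unique)
open import Data.Nat using (ℕ; zero; suc; pred; _+_; _*_; _∸_; _≤_; _<_; _%_; ⌊_/2⌋; z≤n; s≤s; s≤s⁻¹; _≤′_; ≤′-refl; ≤′-step; _≟_; _<?_)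
open import Data.Nat.Induction using (<-wellFounded)
open import Data.Nat.ListAction using (sum)
open import Data.Nat.Properties
  using (≤-refl; ≤-trans; ≤-reflexive; <⇒≤; ≰⇒>; ≮⇒≥; ≤⇒≤′; +-comm; +-suc; suc-injective; 0≢1+n;
         n≤0⇒n≡0; m≤m+n; m≤n+m; m<m+n; m<n+m; m≤n⇒m≤o+n; +-mono-≤; ∸-monoˡ-≤; m≤n⇒m∸n≡0;
         pred-mono-≤; pred[m∸n]≡m∸[1+n]; ⌊n/2⌋<n; m≤n⇒m⊓n≡m; module ≤-Reasoning)
open import Data.Nat.Tactic.RingSolver using (solve-∀)
open import Data.Product using (∃-syntax; _×_; _,_; proj₁; proj₂)
open import Data.Sum using (_⊎_; inj₁; inj₂)
open import Function using (id; _∘_)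
open import Induction.WellFounded using (Acc; acc)
open import Level using (0ℓ)
open import Relation.Binary.PropositionalEquality using (_≡_; refl; sym; trans; cong; subst)
open import Relation.Nullary using (¬_; yes; no)
open import Relation.Unary using (Pred; Decidable)

private
  variable
    A : Set
    a b ℓ n₁ n₂ x l r : ℕ
    X Y S : List A
    B C : Tree
    𝒯 : Tree → Set

Unique-⊆ : X ⊆ S → Unique S → Unique X
Unique-⊆ []          u          = u
Unique-⊆ (_ ∷ʳ X⊆S)  (_ ∷ u)    = Unique-⊆ X⊆S u
Unique-⊆ (refl ∷ X⊆S) (x∉ ∷ u)  = All-resp-⊆ X⊆S x∉ ∷ Unique-⊆ X⊆S u

sublist-of-length : ∀ {n} {S : List A} → n ≤ length S → ∃[ X ] (X ⊆ S × length X ≡ n)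
sublist-of-length {n = n} {S} n≤ = take n S , take-⊆ n S , trans (length-take n S) (m≤n⇒m⊓n≡m n≤)

∈⇒0<length : {x : A} → x ∈ S → 0 < length S
∈⇒0<length (here _)  = s≤s z≤n
∈⇒0<length (there _) = s≤s z≤n

∈⇒≤sum : ∀ {S} → x ∈ S → x ≤ sum S
∈⇒≤sum {S = s ∷ S} (here refl) = m≤m+n s (sum S)
∈⇒≤sum {S = s ∷ S} (there x∈S) = m≤n⇒m≤o+n s (∈⇒≤sum x∈S)

module Partition {P Q : Pred A 0ℓ} (P? : Decidable P) (Q? : Decidable Q)
                 (P⇒¬Q : ∀ {x} → P x → ¬ Q x) (P⊎Q : ∀ x → P x ⊎ Q x) where

  length-partition : ∀ S → length S ≡ length (filter P? S) + length (filter Q? S)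
  length-partition []      = refl
  length-partition (s ∷ S) with P? s | Q? s | P⊎Q s
  ... | yes p  | yes q  | _      = ⊥-elim (P⇒¬Q p q)
  ... | yes _  | no _   | _      = cong suc (length-partition S)
  ... | no _   | yes _  | _      = trans (cong suc (length-partition S)) (sym (+-suc _ _))
  ... | no ¬p  | no _   | inj₁ p = ⊥-elim (¬p p)
  ... | no _   | no ¬q  | inj₂ q = ⊥-elim (¬q q)

  Interleaving : List A → List A → List A → Set
  Interleaving S X Y = ∃[ Z ] (Z ⊆ S × filter P? Z ≡ X × filter Q? Z ≡ Y)

  private
    skip : ∀ {s} → Interleaving S X Y → Interleaving (s ∷ S) X Y
    skip (Z , Z⊆S , eX , eY) = Z , _ ∷ʳ Z⊆S , eX , eY

    keepˡ : ∀ {s} → P s → ¬ Q s → Interleaving S X Y → Interleaving (s ∷ S) (s ∷ X) Y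
    keepˡ p ¬q (Z , Z⊆S , eX , eY) =
      _ ∷ Z , refl ∷ Z⊆S , trans (filter-accept P? p) (cong (_ ∷_) eX) , trans (filter-reject Q? ¬q) eY

    keepʳ : ∀ {s} → ¬ P s → Q s → Interleaving S X Y → Interleaving (s ∷ S) X (s ∷ Y)
    keepʳ ¬p q (Z , Z⊆S , eX , eY) =
      _ ∷ Z , refl ∷ Z⊆S , trans (filter-reject P? ¬p) eX , trans (filter-accept Q? q) (cong (_ ∷_) eY)

  interleave : ∀ S → X ⊆ filter P? S → Y ⊆ filter Q? S → Interleaving S X Y
  interleave [] [] [] = [] , [] , refl , refl
  interleave (s ∷ S) X⊆ Y⊆ with P? s | Q? s
  ... | yes p | yes q = ⊥-elim (P⇒¬Q p q)
  ... | no _  | no _  = skip (interleave S X⊆ Y⊆)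
  interleave (s ∷ S) (_ ∷ʳ X⊆) Y⊆ | yes _ | no _ = skip (interleave S X⊆ Y⊆)
  interleave (s ∷ S) (refl ∷ X⊆) Y⊆ | yes p | no ¬q = keepˡ p ¬q (interleave S X⊆ Y⊆)
  interleave (s ∷ S) X⊆ (_ ∷ʳ Y⊆) | no _ | yes _ = skip (interleave S X⊆ Y⊆)
  interleave (s ∷ S) X⊆ (refl ∷ Y⊆) | no ¬p | yes q = keepʳ ¬p q (interleave S X⊆ Y⊆)

crossing : {P : Pred ℕ 0ℓ} → Decidable P → ¬ P 0 → ∀ n → P n → ∃[ m ] (¬ P m × P (suc m))
crossing P? ¬P0 zero    P0  = ⊥-elim (¬P0 P0)
crossing P? ¬P0 (suc n) Psn with P? n
... | yes Pn  = crossing P? ¬P0 n Pn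
... | no ¬Pn  = n , ¬Pn , Psn

%2≡0⊎%2≡1 : ∀ n → n % 2 ≡ 0 ⊎ n % 2 ≡ 1
%2≡0⊎%2≡1 zero          = inj₁ refl
%2≡0⊎%2≡1 (suc zero)    = inj₂ refl
%2≡0⊎%2≡1 (suc (suc n)) = %2≡0⊎%2≡1 n

⌊/2⌋-%2-injective : ∀ m n → ⌊ m /2⌋ ≡ ⌊ n /2⌋ → m % 2 ≡ n % 2 → m ≡ n
⌊/2⌋-%2-injective zero          zero          _ _  = refl
⌊/2⌋-%2-injective zero          (suc zero)    _ ()
⌊/2⌋-%2-injective zero          (suc (suc n)) () _
⌊/2⌋-%2-injective (suc zero)    zero          _ ()
⌊/2⌋-%2-injective (suc zero)    (suc zero)    _ _  = refl
⌊/2⌋-%2-injective (suc zero)    (suc (suc n)) () _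
⌊/2⌋-%2-injective (suc (suc m)) zero          () _
⌊/2⌋-%2-injective (suc (suc m)) (suc zero)    () _
⌊/2⌋-%2-injective (suc (suc m)) (suc (suc n)) h p =
  cong (2 +_) (⌊/2⌋-%2-injective m n (suc-injective h) p)

⌊n/2⌋≤pred[n] : ∀ n → ⌊ n /2⌋ ≤ pred n
⌊n/2⌋≤pred[n] zero    = z≤n
⌊n/2⌋≤pred[n] (suc n) = s≤s⁻¹ (⌊n/2⌋<n n)

shiftR-≤-∸ : ∀ n s → shiftR n s ≤ s ∸ n
shiftR-≤-∸ zero    s = ≤-refl
shiftR-≤-∸ (suc n) s = begin
  ⌊ shiftR n s /2⌋   ≤⟨ ⌊n/2⌋≤pred[n] (shiftR n s) ⟩
  pred (shiftR n s)  ≤⟨ pred-mono-≤ (shiftR-≤-∸ n s) ⟩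
  pred (s ∸ n)       ≡⟨ pred[m∸n]≡m∸[1+n] s n ⟩
  s ∸ suc n          ∎
  where open ≤-Reasoning

shiftR-vanishes : ∀ {n s} → s ≤ n → shiftR n s ≡ 0
shiftR-vanishes {n} {s} s≤n = n≤0⇒n≡0 (≤-trans (shiftR-≤-∸ n s) (≤-reflexive (m≤n⇒m∸n≡0 s≤n)))

GoesLeft GoesRight : ℕ → ℕ → Set
GoesLeft  ℓ s = shiftR ℓ s % 2 ≡ 0
GoesRight ℓ s = shiftR ℓ s % 2 ≡ 1

left? : ∀ ℓ → Decidable (GoesLeft ℓ)
left? ℓ s = shiftR ℓ s % 2 ≟ 0

right? : ∀ ℓ → Decidable (GoesRight ℓ)
right? ℓ s = shiftR ℓ s % 2 ≟ 1

GoesLeft⇒¬GoesRight : GoesLeft ℓ x → ¬ GoesRight ℓ x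
GoesLeft⇒¬GoesRight x₀ x₁ = 0≢1+n (trans (sym x₀) x₁)

module Halves (ℓ : ℕ) =
  Partition (left? ℓ) (right? ℓ) (GoesLeft⇒¬GoesRight {ℓ}) (λ s → %2≡0⊎%2≡1 (shiftR ℓ s))

length-halves : ∀ ℓ S → length S ≡ length (Left ℓ S) + length (Right ℓ S)
length-halves = Halves.length-partition

Left-⊆ : ∀ ℓ S → Left ℓ S ⊆ S
Left-⊆ ℓ = filter-⊆ (left? ℓ)

Right-⊆ : ∀ ℓ S → Right ℓ S ⊆ S
Right-⊆ ℓ = filter-⊆ (right? ℓ)

Agrees : ℕ → ℕ → List ℕ → Set
Agrees m x S = All (λ s → shiftR m s ≡ shiftR m x) S

agrees-≤′ : ∀ {m n} → m ≤′ n → Agrees m x S → Agrees n x S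
agrees-≤′ ≤′-refl         = id
agrees-≤′ (≤′-step m≤′n) = All.map (cong ⌊_/2⌋) ∘ agrees-≤′ m≤′n

agrees-sum : x ∈ S → Agrees (sum S) x S
agrees-sum x∈S = All.tabulate λ s∈S →
  trans (shiftR-vanishes (∈⇒≤sum s∈S)) (sym (shiftR-vanishes (∈⇒≤sum x∈S)))

IsTopLevel-from-agreement : x ∈ S → ¬ Agrees ℓ x S → Agrees (suc ℓ) x S → IsTopLevel S ℓ
IsTopLevel-from-agreement {x} {S} {ℓ} x∈S ¬agree agree
  with t , t∈S , t≉x ← find (¬All⇒Any¬ (λ s → shiftR ℓ s ≟ shiftR ℓ x) S ¬agree)
  = (t , x , t∈S , x∈S , t≉x) , above
  where
  above : ∀ m → ℓ < m → ∀ s t → s ∈ S → t ∈ S → shiftR m s ≡ shiftR m t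
  above m ℓ<m s t s∈S t∈S = trans (All.lookup agree′ s∈S) (sym (All.lookup agree′ t∈S))
    where
    agree′ : Agrees m x S
    agree′ = agrees-≤′ (≤⇒≤′ ℓ<m) agree

-- S collapses at the level sum S and is separated at level 0 by x ≢ y; the top level is
-- the last level before the collapse.
topLevel-exists : ∀ {x y R} → Unique (x ∷ y ∷ R) → ∃[ ℓ ] IsTopLevel (x ∷ y ∷ R) ℓ
topLevel-exists {x} {y} {R} ((x≢y ∷ _) ∷ _)
  with ℓ , ¬agree , agree ← crossing (λ m → All.all? (λ s → shiftR m s ≟ shiftR m x) (x ∷ y ∷ R))
                                     (λ { (_ ∷ y≡x ∷ _) → x≢y (sym y≡x) })
                                     (sum (x ∷ y ∷ R)) (agrees-sum (here refl))
  = ℓ , IsTopLevel-from-agreement (here refl) ¬agree agree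

-- Two elements that differ at level ℓ but agree at level ℓ + 1 have different parities at level ℓ.
halves-nonempty : IsTopLevel S ℓ → (∃[ l ] l ∈ Left ℓ S) × (∃[ r ] r ∈ Right ℓ S)
halves-nonempty {ℓ = ℓ} ((s , t , s∈ , t∈ , s≉t) , above)
  with above (suc ℓ) ≤-refl s t s∈ t∈ | %2≡0⊎%2≡1 (shiftR ℓ s) | %2≡0⊎%2≡1 (shiftR ℓ t)
... | _ | inj₁ s₀ | inj₂ t₁ = (s , ∈-filter⁺ (left? ℓ) s∈ s₀) , (t , ∈-filter⁺ (right? ℓ) t∈ t₁)
... | _ | inj₂ s₁ | inj₁ t₀ = (t , ∈-filter⁺ (left? ℓ) t∈ t₀) , (s , ∈-filter⁺ (right? ℓ) s∈ s₁)
... | h | inj₁ s₀ | inj₁ t₀ = ⊥-elim (s≉t (⌊/2⌋-%2-injective _ _ h (trans s₀ (sym t₀))))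
... | h | inj₂ s₁ | inj₂ t₁ = ⊥-elim (s≉t (⌊/2⌋-%2-injective _ _ h (trans s₁ (sym t₁))))

Left-nonempty : IsTopLevel S ℓ → 0 < length (Left ℓ S)
Left-nonempty = ∈⇒0<length ∘ proj₂ ∘ proj₁ ∘ halves-nonempty

Right-nonempty : IsTopLevel S ℓ → 0 < length (Right ℓ S)
Right-nonempty = ∈⇒0<length ∘ proj₂ ∘ proj₂ ∘ halves-nonempty

Left-shorter : IsTopLevel S ℓ → length (Left ℓ S) < length S
Left-shorter {S} {ℓ} top =
  subst (length (Left ℓ S) <_) (sym (length-halves ℓ S)) (m<m+n _ (Right-nonempty top))

Right-shorter : IsTopLevel S ℓ → length (Right ℓ S) < length S
Right-shorter {S} {ℓ} top =
  subst (length (Right ℓ S) <_) (sym (length-halves ℓ S)) (m<n+m _ (Left-nonempty top))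

IsTopLevel-⊆ : IsTopLevel S ℓ → X ⊆ S →
               (∃[ l ] l ∈ Left ℓ X) → (∃[ r ] r ∈ Right ℓ X) → IsTopLevel X ℓ
IsTopLevel-⊆ {ℓ = ℓ} (_ , above) X⊆S (l , l∈) (r , r∈)
  with l∈X , l₀ ← ∈-filter⁻ (left? ℓ) l∈ | r∈X , r₁ ← ∈-filter⁻ (right? ℓ) r∈
  = (l , r , l∈X , r∈X , λ l≡r → GoesLeft⇒¬GoesRight {ℓ} l₀ (trans (cong (_% 2) l≡r) r₁)) ,
    λ m ℓ<m s t s∈ t∈ → above m ℓ<m s t (Any-resp-⊆ X⊆S s∈) (Any-resp-⊆ X⊆S t∈)

BinStr-nonempty : BinStr X B → ∃[ x ] x ∈ X
BinStr-nonempty (single x)                                 = x , here refl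
BinStr-nonempty (split _ _ _ _ ((s , _ , s∈ , _) , _) _ _) = s , s∈

BinStr-exists : ∀ S → Unique S → 0 < length S → ∃[ B ] BinStr S B
BinStr-exists S = go S (<-wellFounded (length S))
  where
  go : ∀ S → Acc _<_ (length S) → Unique S → 0 < length S → ∃[ B ] BinStr S B
  go (x ∷ []) _ _ _ = leaf 1 , single x
  go S@(_ ∷ _ ∷ _) (acc rec) u _
    with ℓ , top ← topLevel-exists u
    with B , bL ← go (Left ℓ S) (rec (Left-shorter top)) (Unique-⊆ (Left-⊆ ℓ S) u) (Left-nonempty top)
       | C , bR ← go (Right ℓ S) (rec (Right-shorter top)) (Unique-⊆ (Right-⊆ ℓ S) u) (Right-nonempty top)
    = node (length S) B C , split S ℓ B C top bL bR

BinStr-join : IsTopLevel S ℓ → X ⊆ Left ℓ S → Y ⊆ Right ℓ S → BinStr X B → BinStr Y C →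
              ∃[ Z ] (Z ⊆ S × length Z ≡ length X + length Y × BinStr Z (node (length Z) B C))
BinStr-join {S} {ℓ} top X⊆ Y⊆ bX bY with Z , Z⊆S , refl , refl ← Halves.interleave ℓ S X⊆ Y⊆
  = Z , Z⊆S , length-halves ℓ Z ,
    split Z ℓ _ _ (IsTopLevel-⊆ top Z⊆S (BinStr-nonempty bX) (BinStr-nonempty bY)) bX bY

Prunes-leaf : BinStr X B → Prunes B (leaf (length X))
Prunes-leaf (single _)            = cut _
Prunes-leaf (split _ _ _ _ _ _ _) = cut _

Prunes-root : ∀ {w} → BinStr X B → BinStr Y C → length X ≡ a → length Y ≡ b → w ≡ length X + length Y →
              Prunes (node w B C) T[ a , b ]
Prunes-root bX bY refl refl refl = node _ _ _ _ _ (Prunes-leaf bX) (Prunes-leaf bY)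

singleton-increasing : ∀ x → HasIncreasingStructure [ x ]
singleton-increasing x = leaf 1 , single x , leaf 1

singleton-decreasing : ∀ x → HasDecreasingStructure [ x ]
singleton-decreasing x = leaf 1 , single x , leaf 1

increasing-extend : IsTopLevel S ℓ → r ∈ Right ℓ S → X ⊆ Left ℓ S → HasIncreasingStructure X →
                    ∃[ Y ] (Y ⊆ S × length Y ≡ suc (length X) × HasIncreasingStructure Y)
increasing-extend {r = r} top r∈ X⊆ (B , bX , incB)
  with Y , Y⊆S , |Y| , bY ← BinStr-join top X⊆ (from∈ r∈) bX (single r)
  = Y , Y⊆S , trans |Y| (+-comm _ 1) , node _ B (leaf 1) , bY , node _ B 1 incB

decreasing-extend : IsTopLevel S ℓ → l ∈ Left ℓ S → X ⊆ Right ℓ S → HasDecreasingStructure X →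
                    ∃[ Y ] (Y ⊆ S × length Y ≡ suc (length X) × HasDecreasingStructure Y)
decreasing-extend {l = l} top l∈ X⊆ (B , bX , decB)
  with Y , Y⊆S , |Y| , bY ← BinStr-join top (from∈ l∈) X⊆ (single l) bX
  = Y , Y⊆S , |Y| , node _ (leaf 1) B , bY , node _ 1 B decB

OfType-split : IsTopLevel S ℓ → Unique S → 1 ≤ a → 1 ≤ b →
               a ≤ length (Left ℓ S) → b ≤ length (Right ℓ S) → ∃[ Z ] (Z ⊆ S × OfType Z T[ a , b ])
OfType-split {S} {ℓ} top u 1≤a 1≤b a≤ b≤
  with X , X⊆ , |X| ← sublist-of-length a≤ | Y , Y⊆ , |Y| ← sublist-of-length b≤
  with B , bX ← BinStr-exists X (Unique-⊆ (⊆-trans X⊆ (Left-⊆ ℓ S)) u) (subst (1 ≤_) (sym |X|) 1≤a)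
     | C , bY ← BinStr-exists Y (Unique-⊆ (⊆-trans Y⊆ (Right-⊆ ℓ S)) u) (subst (1 ≤_) (sym |Y|) 1≤b)
  with Z , Z⊆S , |Z| , bZ ← BinStr-join top X⊆ Y⊆ bX bY
  = Z , Z⊆S , node _ B C , bZ , Prunes-root bX bY |X| |Y| |Z|

Avoids-Left : IsTopLevel S ℓ → Avoids (suc n₁) n₂ 𝒯 S → Avoids n₁ n₂ 𝒯 (Left ℓ S)
Avoids-Left {S} {ℓ} top (noInc , noDec , noType) with _ , (r , r∈) ← halves-nonempty top =
  (λ X X⊆ |X| inc → let Y , Y⊆S , |Y| , incY = increasing-extend top r∈ X⊆ inc
                    in noInc Y Y⊆S (trans |Y| (cong suc |X|)) incY) ,
  (λ X X⊆ → noDec X (⊆-trans X⊆ (Left-⊆ ℓ S))) ,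
  (λ X T X⊆ → noType X T (⊆-trans X⊆ (Left-⊆ ℓ S)))

Avoids-Right : IsTopLevel S ℓ → Avoids n₁ (suc n₂) 𝒯 S → Avoids n₁ n₂ 𝒯 (Right ℓ S)
Avoids-Right {S} {ℓ} top (noInc , noDec , noType) with (l , l∈) , _ ← halves-nonempty top =
  (λ X X⊆ → noInc X (⊆-trans X⊆ (Right-⊆ ℓ S))) ,
  (λ X X⊆ |X| dec → let Y , Y⊆S , |Y| , decY = decreasing-extend top l∈ X⊆ dec
                    in noDec Y Y⊆S (trans |Y| (cong suc |X|)) decY) ,
  (λ X T X⊆ → noType X T (⊆-trans X⊆ (Right-⊆ ℓ S)))

halves-not-both-large : 𝒯 T[ a , b ] → IsType T[ a , b ] → Unique S → Avoids n₁ n₂ 𝒯 S →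
                        IsTopLevel S ℓ → a ≤ length (Left ℓ S) → b ≤ length (Right ℓ S) → ⊥
halves-not-both-large 𝒯T (node _ _ (leaf _ 1≤a) (leaf _ 1≤b)) u (_ , _ , noType) top a≤ b≤
  with Z , Z⊆S , ofType ← OfType-split top u 1≤a 1≤b a≤ b≤
  = noType Z _ Z⊆S 𝒯T ofType

module SizeBound (𝒯 : Tree → Set) (k : ℕ) (1≤k : 1 ≤ k) (𝒯-types : ∀ T → 𝒯 T → IsType T × weight T ≡ k)
                 (amin bmin : ℕ) (Tamin : ∃[ b ] 𝒯 T[ amin , b ]) (Tbmin : ∃[ a ] 𝒯 T[ a , bmin ]) where

  bound : ℕ → ℕ → ℕ
  bound m₁ m₂ = (amin ∸ 1) * m₂ + (bmin ∸ 1) * m₁ + 2 * k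

  bound-sucʳ : ∀ m₁ m₂ → (amin ∸ 1) + bound m₁ m₂ ≡ bound m₁ (suc m₂)
  bound-sucʳ m₁ m₂ = identity (amin ∸ 1) (bmin ∸ 1) (2 * k) m₁ m₂
    where
    identity : ∀ c d e m₁ m₂ → c + (c * m₂ + d * m₁ + e) ≡ c * suc m₂ + d * m₁ + e
    identity = solve-∀

  bound-sucˡ : ∀ m₁ m₂ → bound m₁ m₂ + (bmin ∸ 1) ≡ bound (suc m₁) m₂
  bound-sucˡ m₁ m₂ = identity (amin ∸ 1) (bmin ∸ 1) (2 * k) m₁ m₂
    where
    identity : ∀ c d e m₁ m₂ → c * m₂ + d * m₁ + e + d ≡ c * m₂ + d * suc m₁ + e
    identity = solve-∀

  2k≤bound : ∀ m₁ m₂ → k + k ≤ bound m₁ m₂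
  2k≤bound m₁ m₂ = subst (_≤ bound m₁ m₂) (double k) (m≤n+m (2 * k) ((amin ∸ 1) * m₂ + (bmin ∸ 1) * m₁))
    where
    double : ∀ k → 2 * k ≡ k + k
    double = solve-∀

  Left-≤-k : Unique S → Avoids n₁ n₂ 𝒯 S → IsTopLevel S ℓ → bmin ≤ length (Right ℓ S) → length (Left ℓ S) ≤ k
  Left-≤-k u av top bmin≤ =
    let a , 𝒯T = Tbmin ; tT , wT = 𝒯-types _ 𝒯T in
    ≤-trans (<⇒≤ (≰⇒> λ a≤ → halves-not-both-large 𝒯T tT u av top a≤ bmin≤))
            (≤-trans (m≤m+n a bmin) (≤-reflexive wT))

  Right-≤-k : Unique S → Avoids n₁ n₂ 𝒯 S → IsTopLevel S ℓ → amin ≤ length (Left ℓ S) → length (Right ℓ S) ≤ k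
  Right-≤-k u av top amin≤ =
    let b , 𝒯T = Tamin ; tT , wT = 𝒯-types _ 𝒯T in
    ≤-trans (<⇒≤ (≰⇒> λ b≤ → halves-not-both-large 𝒯T tT u av top amin≤ b≤))
            (≤-trans (m≤n+m b amin) (≤-reflexive wT))

  length-bound : ∀ m₁ m₂ S → Unique S → Avoids (2 + m₁) (2 + m₂) 𝒯 S → length S ≤ bound m₁ m₂
  length-bound-Left<amin : ∀ m₁ m₂ → IsTopLevel S ℓ → Unique S → Avoids (2 + m₁) (2 + m₂) 𝒯 S →
                           length (Left ℓ S) < amin → length S ≤ bound m₁ m₂
  length-bound-Right<bmin : ∀ m₁ m₂ → IsTopLevel S ℓ → Unique S → Avoids (2 + m₁) (2 + m₂) 𝒯 S →
                            length (Right ℓ S) < bmin → length S ≤ bound m₁ m₂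

  length-bound m₁ m₂ []       _ _ = z≤n
  length-bound m₁ m₂ (_ ∷ []) _ _ = ≤-trans 1≤k (≤-trans (m≤m+n k k) (2k≤bound m₁ m₂))
  length-bound m₁ m₂ S@(_ ∷ _ ∷ _) u av
    with ℓ , top ← topLevel-exists u
    with length (Left ℓ S) <? amin | length (Right ℓ S) <? bmin
  ... | yes L<amin | _          = length-bound-Left<amin m₁ m₂ top u av L<amin
  ... | no _       | yes R<bmin = length-bound-Right<bmin m₁ m₂ top u av R<bmin
  ... | no L≮amin  | no R≮bmin  = begin
    length S                                ≡⟨ length-halves ℓ S ⟩
    length (Left ℓ S) + length (Right ℓ S)  ≤⟨ +-mono-≤ (Left-≤-k u av top (≮⇒≥ R≮bmin))
                                                        (Right-≤-k u av top (≮⇒≥ L≮amin)) ⟩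
    k + k                                   ≤⟨ 2k≤bound m₁ m₂ ⟩
    bound m₁ m₂                             ∎
    where open ≤-Reasoning

  length-bound-Left<amin m₁ zero top u av _
    with _ , noDec , _ ← Avoids-Right top av | r , r∈ ← proj₂ (halves-nonempty top)
    = ⊥-elim (noDec [ r ] (from∈ r∈) refl (singleton-decreasing r))
  length-bound-Left<amin {S} {ℓ} m₁ (suc m₂) top u av L<amin = begin
    length S                                ≡⟨ length-halves ℓ S ⟩
    length (Left ℓ S) + length (Right ℓ S)  ≤⟨ +-mono-≤ (∸-monoˡ-≤ 1 L<amin) R≤ ⟩
    (amin ∸ 1) + bound m₁ m₂                ≡⟨ bound-sucʳ m₁ m₂ ⟩
    bound m₁ (suc m₂)                       ∎
    where
    open ≤-Reasoning
    R≤ : length (Right ℓ S) ≤ bound m₁ m₂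
    R≤ = length-bound m₁ m₂ (Right ℓ S) (Unique-⊆ (Right-⊆ ℓ S) u) (Avoids-Right top av)

  length-bound-Right<bmin zero m₂ top u av _
    with noInc , _ , _ ← Avoids-Left top av | l , l∈ ← proj₁ (halves-nonempty top)
    = ⊥-elim (noInc [ l ] (from∈ l∈) refl (singleton-increasing l))
  length-bound-Right<bmin {S} {ℓ} (suc m₁) m₂ top u av R<bmin = begin
    length S                                ≡⟨ length-halves ℓ S ⟩
    length (Left ℓ S) + length (Right ℓ S)  ≤⟨ +-mono-≤ L≤ (∸-monoˡ-≤ 1 R<bmin) ⟩
    bound m₁ m₂ + (bmin ∸ 1)                ≡⟨ bound-sucˡ m₁ m₂ ⟩
    bound (suc m₁) m₂                       ∎
    where
    open ≤-Reasoning
    L≤ : length (Left ℓ S) ≤ bound m₁ m₂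
    L≤ = length-bound m₁ m₂ (Left ℓ S) (Unique-⊆ (Left-⊆ ℓ S) u) (Avoids-Left top av)

lemma2p9 : (n₁ n₂ k : ℕ) → 2 ≤ n₁ → 2 ≤ n₂ → 1 ≤ k →
    (𝒯 : Tree → Set) → (∀ T → 𝒯 T → IsType T × weight T ≡ k) →
    (amin bmin : ℕ) →
    (∃[ b ] 𝒯 T[ amin , b ]) → (∀ a b → 𝒯 T[ a , b ] → amin ≤ a) →
    (∃[ a ] 𝒯 T[ a , bmin ]) → (∀ a b → 𝒯 T[ a , b ] → bmin ≤ b) →
    (S : List ℕ) → Unique S → Avoids n₁ n₂ 𝒯 S →
    length S ≤ (amin ∸ 1) * (n₂ ∸ 2) + (bmin ∸ 1) * (n₁ ∸ 2) + 2 * k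
lemma2p9 (suc (suc m₁)) (suc (suc m₂)) k (s≤s (s≤s z≤n)) (s≤s (s≤s z≤n)) 1≤k 𝒯 𝒯-types amin bmin Tamin _ Tbmin _ =
  SizeBound.length-bound 𝒯 k 1≤k 𝒯-types amin bmin Tamin Tbmin m₁ m₂
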